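{- Let $n\ge 3$, let $\overrightarrow{C_n}$ be an oriented cycle and $D$ a nonempty set of finite distances of $\overrightarrow{C_n}$ with $n-1\in D$. If $\overrightarrow{C_n}$ is $D$-antimagic, then $\overrightarrow{C_n}$ is unidirectional.
   Context: An oriented cycle is an orientation of the cycle on vertices $v_1,\dots,v_n$. It is unidirectional if (for a suitable labeling) its arcs are $(v_i,v_{i+1})$, $1\le i\le n-1$, and $(v_n,v_1)$. $d(u,y)$ is the length of a shortest directed path from $u$ to $y$ ($d(u,u)=0$, $\infty$ if none). $N_D(v)=\{y:d(v,y)\in D\}$; a bijection $f:V\to\{1,\dots,n\}$ is $D$-antimagic if $\omega_D(v)=\sum_{y\in N_D(v)}f(y)$ are pairwise distinct; the graph is $D$-antimagic if such a bijection exists. -}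

module Defs where

open import Data.Nat using (ℕ; zero; suc; _+_; _<_; _∸_)
open import Data.Nat.DivMod using (_mod_)
open import Data.Fin using (Fin; toℕ)
open import Data.Bool using (Bool; true; false; if_then_else_)
open import Data.Product using (Σ; ∃; _×_; _,_)
open import Data.Sum using (_⊎_)
open import Relation.Binary.PropositionalEquality using (_≡_; _≢_)
open import Relation.Nullary using (¬_)
open import Relation.Unary using (Pred)
open import Function.Bundles using (_⤖_; _⇔_; Bijection)
open import Level using (0ℓ)

-- cyclic successor on the vertex set Fin n (vertex i is v_{i+1} of the paper)
next : ∀ {n} → Fin n → Fin n
next {suc m} i = suc (toℕ i) mod suc m

-- An oriented cycle on n vertices: for each underlying edge {i, i+1 mod n}
-- the orientation o i says whether it is the arc (i, i+1) [true] or (i+1, i) [false].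
Orientation : ℕ → Set
Orientation n = Fin n → Bool

data Arc {n : ℕ} (o : Orientation n) : Fin n → Fin n → Set where
  fwd : ∀ i → o i ≡ true  → Arc o i (next i)
  bwd : ∀ i → o i ≡ false → Arc o (next i) i

data Walk {n : ℕ} (o : Orientation n) : ℕ → Fin n → Fin n → Set where
  here : ∀ u → Walk o 0 u u
  step : ∀ {k u w y} → Arc o u w → Walk o k w y → Walk o (suc k) u y

-- d(u,y) = k  (length of a shortest directed path/walk from u to y; finite distances only)
Dist : ∀ {n} → Orientation n → Fin n → Fin n → ℕ → Set
Dist o u y k = Walk o k u y × (∀ j → j < k → ¬ Walk o j u y)

-- unidirectional: for a suitable labeling σ (σ i = v_{i+1}), the arcs are exactly (σ i, σ (i+1 mod n))
Unidirectional : ∀ {n} → Orientation n → Set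
Unidirectional {n} o =
  Σ (Fin n ⤖ Fin n) λ σ → let open Bijection σ renaming (to to s) in
    ∀ u v → Arc o u v ⇔ (∃ λ i → u ≡ s i × v ≡ s (next i))

sumFin : ∀ {n} → (Fin n → ℕ) → ℕ
sumFin {zero} g = 0
sumFin {suc n} g = g Fin.zero + sumFin {n} (λ i → g (Fin.suc i))

-- D-antimagic: a bijection f : V → {1..n} (value of y is 1 + f y) such that
-- ω_D(v) = Σ_{y ∈ N_D(v)} f(y) are pairwise distinct; N v is the indicator of N_D(v).
DAntimagic : ∀ {n} → Orientation n → Pred ℕ 0ℓ → Set
DAntimagic {n} o D =
  Σ (Fin n ⤖ Fin n) λ f → let open Bijection f renaming (to to g) in
  Σ (Fin n → Fin n → Bool) λ N →
    (∀ v y → (N v y ≡ true) ⇔ (∃ λ k → Dist o v y k × D k)) ×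
    (let ω : Fin n → ℕ
         ω v = sumFin (λ y → if N v y then suc (toℕ (g y)) else 0)
     in ∀ u v → u ≢ v → ω u ≢ ω v)

-- Along an oriented cycle a walk can never turn back: leaving an edge in the direction
-- opposite to the one in which it was entered would require that edge to be oriented
-- both ways.  So every walk runs in one direction over consecutive edges, all oriented
-- alike.  A shortest path of length n − 1 from u to y covers every edge except the one
-- joining y and u; if that edge were oriented the other way it would be an arc from
-- u to y, so d(u, y) = 1 < n − 1.  Hence all edges are oriented alike and the cycle is
-- unidirectional.
module Submission where

open import Defs
open import Data.Nat using (ℕ; NonZero; _≤_; _∸_; zero; suc; _+_; _<_; s≤s; z≤n; _%_)
open import Data.Nat.Properties
  using (+-suc; +-assoc; +-comm; +-∸-assoc; m+[n∸m]≡n; m∸n≤m; n∸n≡0; m<1+n⇒m<n∨m≡n; <⇒≤; n<1+n)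
open import Data.Nat.DivMod
  using (m%n<n; %-distribˡ-+; m%n%n≡m%n; [m+n]%n≡m%n; m<n⇒m%n≡m; n%n≡0)
open import Data.Fin using (Fin; toℕ; opposite)
open import Data.Fin.Properties using (toℕ-injective; toℕ-fromℕ<; toℕ<n; opposite-prop; opposite-involutive)
open import Data.Bool using (Bool; true; false)
open import Data.Bool.Properties using (not-¬)
open import Data.Product using (∃; _×_; _,_; proj₁)
open import Data.Sum using (_⊎_; inj₁; inj₂)
open import Data.Empty using (⊥-elim)
open import Relation.Binary.PropositionalEquality
open import Relation.Nullary using (¬_)
open import Relation.Unary using (Pred)
open import Level using (0ℓ)
open import Function.Bundles using (_⤖_; mk⇔; mk↔ₛ′)
open import Function.Construct.Identity using (⤖-id)
open import Function.Properties.Inverse using (↔⇒⤖)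

private variable m : ℕ

_⊕_ : Fin (suc m) → ℕ → Fin (suc m)
a ⊕ zero  = a
a ⊕ suc j = next (a ⊕ j)

toℕ-next : (i : Fin (suc m)) → toℕ (next i) ≡ suc (toℕ i) % suc m
toℕ-next {m} i = toℕ-fromℕ< (m%n<n (suc (toℕ i)) (suc m))

[m+n%d]%d≡[m+n]%d : ∀ m n d .{{_ : NonZero d}} → (m + n % d) % d ≡ (m + n) % d
[m+n%d]%d≡[m+n]%d m n d = begin
  (m + n % d) % d          ≡⟨ %-distribˡ-+ m (n % d) d ⟩
  (m % d + n % d % d) % d  ≡⟨ cong (λ t → (m % d + t) % d) (m%n%n≡m%n n d) ⟩
  (m % d + n % d) % d      ≡⟨ %-distribˡ-+ m n d ⟨
  (m + n) % d              ∎
  where open ≡-Reasoning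

toℕ-⊕ : (a : Fin (suc m)) (j : ℕ) → toℕ (a ⊕ j) ≡ (toℕ a + j) % suc m
toℕ-⊕ {m} a zero = begin
  toℕ a                ≡⟨ m<n⇒m%n≡m (toℕ<n a) ⟨
  toℕ a % suc m        ≡⟨ cong (_% suc m) (+-comm 0 (toℕ a)) ⟩
  (toℕ a + 0) % suc m  ∎
  where open ≡-Reasoning
toℕ-⊕ {m} a (suc j) = begin
  toℕ (next (a ⊕ j))                 ≡⟨ toℕ-next (a ⊕ j) ⟩
  suc (toℕ (a ⊕ j)) % suc m          ≡⟨ cong (λ t → suc t % suc m) (toℕ-⊕ a j) ⟩
  (1 + (toℕ a + j) % suc m) % suc m  ≡⟨ [m+n%d]%d≡[m+n]%d 1 (toℕ a + j) (suc m) ⟩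
  suc (toℕ a + j) % suc m            ≡⟨ cong (_% suc m) (+-suc (toℕ a) j) ⟨
  (toℕ a + suc j) % suc m            ∎
  where open ≡-Reasoning

next-⊕ : (a : Fin (suc m)) (j : ℕ) → next a ⊕ j ≡ a ⊕ suc j
next-⊕ a zero    = refl
next-⊕ a (suc j) = cong next (next-⊕ a j)

⊕-period : (a : Fin (suc m)) → a ⊕ suc m ≡ a
⊕-period {m} a = toℕ-injective (begin
  toℕ (a ⊕ suc m)          ≡⟨ toℕ-⊕ a (suc m) ⟩
  (toℕ a + suc m) % suc m  ≡⟨ [m+n]%n≡m%n (toℕ a) (suc m) ⟩
  toℕ a % suc m            ≡⟨ m<n⇒m%n≡m (toℕ<n a) ⟩
  toℕ a                    ∎)
  where open ≡-Reasoning

next-injective : {x y : Fin (suc m)} → next x ≡ next y → x ≡ y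
next-injective {m} {x} {y} eq = begin
  x             ≡⟨ ⊕-period x ⟨
  x ⊕ suc m     ≡⟨ next-⊕ x m ⟨
  next x ⊕ m    ≡⟨ cong (_⊕ m) eq ⟩
  next y ⊕ m    ≡⟨ next-⊕ y m ⟩
  y ⊕ suc m     ≡⟨ ⊕-period y ⟩
  y             ∎
  where open ≡-Reasoning

⊕-surjective : (a i : Fin (suc m)) → ∃ λ j → j < suc m × a ⊕ j ≡ i
⊕-surjective {m} a i = j , m%n<n (toℕ i + (suc m ∸ toℕ a)) (suc m) , toℕ-injective (begin
  toℕ (a ⊕ j)                                  ≡⟨ toℕ-⊕ a j ⟩
  (toℕ a + j) % suc m                          ≡⟨ [m+n%d]%d≡[m+n]%d (toℕ a) _ (suc m) ⟩
  (toℕ a + (toℕ i + (suc m ∸ toℕ a))) % suc m  ≡⟨ cong (_% suc m) rearrange ⟩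
  (toℕ i + suc m) % suc m                      ≡⟨ [m+n]%n≡m%n (toℕ i) (suc m) ⟩
  toℕ i % suc m                                ≡⟨ m<n⇒m%n≡m (toℕ<n i) ⟩
  toℕ i                                        ∎)
  where
  open ≡-Reasoning
  j = (toℕ i + (suc m ∸ toℕ a)) % suc m
  rearrange : toℕ a + (toℕ i + (suc m ∸ toℕ a)) ≡ toℕ i + suc m
  rearrange = begin
    toℕ a + (toℕ i + (suc m ∸ toℕ a))  ≡⟨ +-assoc (toℕ a) (toℕ i) _ ⟨
    toℕ a + toℕ i + (suc m ∸ toℕ a)    ≡⟨ cong (_+ (suc m ∸ toℕ a)) (+-comm (toℕ a) (toℕ i)) ⟩
    toℕ i + toℕ a + (suc m ∸ toℕ a)    ≡⟨ +-assoc (toℕ i) (toℕ a) _ ⟩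
    toℕ i + (toℕ a + (suc m ∸ toℕ a))  ≡⟨ cong (toℕ i +_) (m+[n∸m]≡n (<⇒≤ (toℕ<n a))) ⟩
    toℕ i + suc m                      ∎

next-opposite-next : (i : Fin (suc m)) → next (opposite (next i)) ≡ opposite i
next-opposite-next {m} i = toℕ-injective (begin
  toℕ (next (opposite (next i)))         ≡⟨ toℕ-next (opposite (next i)) ⟩
  suc (toℕ (opposite (next i))) % suc m  ≡⟨ cong (λ t → suc t % suc m) (opposite-prop (next i)) ⟩
  suc (m ∸ toℕ (next i)) % suc m         ≡⟨ cong (λ t → suc (m ∸ t) % suc m) (toℕ-next i) ⟩
  suc (m ∸ suc (toℕ i) % suc m) % suc m  ≡⟨ reflect (m<1+n⇒m<n∨m≡n (toℕ<n i)) ⟩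
  m ∸ toℕ i                              ≡⟨ opposite-prop i ⟨
  toℕ (opposite i)                       ∎)
  where
  open ≡-Reasoning
  reflect : toℕ i < m ⊎ toℕ i ≡ m → suc (m ∸ suc (toℕ i) % suc m) % suc m ≡ m ∸ toℕ i
  reflect (inj₁ i<m) = begin
    suc (m ∸ suc (toℕ i) % suc m) % suc m ≡⟨ cong (λ t → suc (m ∸ t) % suc m) (m<n⇒m%n≡m (s≤s i<m)) ⟩
    suc (m ∸ suc (toℕ i)) % suc m         ≡⟨ cong (_% suc m) (+-∸-assoc 1 i<m) ⟨
    (m ∸ toℕ i) % suc m                   ≡⟨ m<n⇒m%n≡m (s≤s (m∸n≤m m (toℕ i))) ⟩
    m ∸ toℕ i                             ∎
  reflect (inj₂ i≡m) = begin
    suc (m ∸ suc (toℕ i) % suc m) % suc m ≡⟨ cong (λ t → suc (m ∸ suc t % suc m) % suc m) i≡m ⟩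
    suc (m ∸ suc m % suc m) % suc m       ≡⟨ cong (λ t → suc (m ∸ t) % suc m) (n%n≡0 (suc m)) ⟩
    suc m % suc m                         ≡⟨ n%n≡0 (suc m) ⟩
    0                                     ≡⟨ n∸n≡0 m ⟨
    m ∸ m                                 ≡⟨ cong (m ∸_) i≡m ⟨
    m ∸ toℕ i                             ∎

module _ (o : Orientation (suc m)) where

  -- Run true k a b: a forward path of length k from a to b; Run false k b a: a backward one.
  Run : Bool → ℕ → Fin (suc m) → Fin (suc m) → Set
  Run c k a b = (∀ j → j < k → o (a ⊕ j) ≡ c) × b ≡ a ⊕ k

  private variable
    c c′ : Bool
    k : ℕ
    a b : Fin (suc m)

  run-cons : o a ≡ c → Run c k (next a) b → Run c (suc k) a b
  run-cons {a = a} {c = c} {k = k} oa (edges , b≡) = edges′ , trans b≡ (next-⊕ a k)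
    where
    edges′ : ∀ j → j < suc k → o (a ⊕ j) ≡ c
    edges′ zero    _         = oa
    edges′ (suc j) (s≤s j<k) = trans (cong o (sym (next-⊕ a j))) (edges j j<k)

  run-snoc : Run c k a b → o b ≡ c → Run c (suc k) a (next b)
  run-snoc {c = c} {k = k} {a = a} (edges , refl) ob = edges′ , refl
    where
    edges′ : ∀ j → j < suc k → o (a ⊕ j) ≡ c
    edges′ j j<1+k with m<1+n⇒m<n∨m≡n j<1+k
    ... | inj₁ j<k  = edges j j<k
    ... | inj₂ refl = ob

  run-reverse₀ : Run c 0 a b → Run c′ 0 b a
  run-reverse₀ (_ , refl) = (λ _ ()) , refl

  run-last : Run c (suc k) a (next b) → o b ≡ c
  run-last {k = k} (edges , eq) = trans (cong o (next-injective eq)) (edges k (n<1+n k))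

  -- A walk cannot go back over the edge it has just used.
  run-after-fwd : o a ≡ true → Run false k b (next a) → Run true k (next a) b
  run-after-fwd {k = zero}  _  r = run-reverse₀ r
  run-after-fwd {k = suc k} oa r = ⊥-elim (not-¬ oa (run-last r))

  run-after-bwd : o a ≡ false → Run true k a b → Run false k b a
  run-after-bwd {k = zero}  _  r            = run-reverse₀ r
  run-after-bwd {k = suc k} oa (edges , _) = ⊥-elim (not-¬ (edges 0 (s≤s z≤n)) oa)

  walk⇒run : Walk o k a b → Run true k a b ⊎ Run false k b a
  walk⇒run (here _) = inj₁ ((λ _ ()) , refl)
  walk⇒run (step (fwd a oa) w) with walk⇒run w
  ... | inj₁ r = inj₁ (run-cons oa r)
  ... | inj₂ r = inj₁ (run-cons oa (run-after-fwd oa r))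
  walk⇒run (step (bwd a oa) w) with walk⇒run w
  ... | inj₁ r = inj₂ (run-snoc (run-after-bwd oa r) oa)
  ... | inj₂ r = inj₂ (run-snoc r oa)

  run-around : Run c (suc m) a b → ∀ i → o i ≡ c
  run-around {a = a} (edges , _) i with ⊕-surjective a i
  ... | j , j<1+m , refl = edges j j<1+m

  run-closes : Run c m a b → next b ≡ a
  run-closes {a = a} (_ , refl) = ⊕-period a

  shortest⇒¬arc : Dist o a b k → 1 < k → ¬ Arc o a b
  shortest⇒¬arc (_ , shortest) 1<k arc = shortest 1 1<k (step arc (here _))

  diameter⇒uniform : 1 < m → Dist o a b m → ∃ λ c → ∀ i → o i ≡ c
  diameter⇒uniform {a = a} {b = b} 1<m d with walk⇒run (proj₁ d)
  ... | inj₁ r = true , run-around (run-snoc r closing)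
    where
    closing : o b ≡ true
    closing with o b in ob
    ... | true  = refl
    ... | false = ⊥-elim (shortest⇒¬arc d 1<m (subst (λ x → Arc o x b) (run-closes r) (bwd b ob)))
  ... | inj₂ r = false , run-around (run-snoc r closing)
    where
    closing : o a ≡ false
    closing with o a in oa
    ... | false = refl
    ... | true  = ⊥-elim (shortest⇒¬arc d 1<m (subst (Arc o a) (run-closes r) (fwd a oa)))

reversal : Fin (suc m) ⤖ Fin (suc m)
reversal = ↔⇒⤖ (mk↔ₛ′ opposite opposite opposite-involutive opposite-involutive)

uniform⇒Unidirectional : (o : Orientation (suc m)) (c : Bool) → (∀ i → o i ≡ c) → Unidirectional o
uniform⇒Unidirectional o true all = ⤖-id _ , λ u v → mk⇔ to from
  where
  to : ∀ {u v} → Arc o u v → ∃ λ i → u ≡ i × v ≡ next i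
  to (fwd i _)  = i , refl , refl
  to (bwd i oi) = ⊥-elim (not-¬ (all i) oi)
  from : ∀ {u v} → (∃ λ i → u ≡ i × v ≡ next i) → Arc o u v
  from (i , refl , refl) = fwd i (all i)
uniform⇒Unidirectional o false all = reversal , λ u v → mk⇔ to from
  where
  to : ∀ {u v} → Arc o u v → ∃ λ i → u ≡ opposite i × v ≡ opposite (next i)
  to (fwd i oi) = ⊥-elim (not-¬ oi (all i))
  to (bwd j _)  = opposite (next j) , sym (opposite-involutive (next j)) ,
    sym (next-injective (trans (next-opposite-next (opposite (next j))) (opposite-involutive (next j))))
  from : ∀ {u v} → (∃ λ i → u ≡ opposite i × v ≡ opposite (next i)) → Arc o u v
  from (i , refl , refl) = subst (λ x → Arc o x (opposite (next i))) (next-opposite-next i) (bwd _ (all _))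

mainTheorem14 : (n : ℕ) → 3 ≤ n → (o : Orientation n) → (D : Pred ℕ 0ℓ) →
    (∃ λ k → D k) →
    (∀ k → D k → ∃ λ (u : Fin n) → ∃ λ (y : Fin n) → Dist o u y k) →
    D (n ∸ 1) →
    DAntimagic o D → Unidirectional o
mainTheorem14 1 (s≤s ()) _ _ _ _ _ _
mainTheorem14 2 (s≤s (s≤s ())) _ _ _ _ _ _
mainTheorem14 (suc (suc (suc _))) _ o _ _ realised Dn-1 _ with realised _ Dn-1
... | _ , _ , d with diameter⇒uniform o (s≤s (s≤s z≤n)) d
... | c , uniform = uniform⇒Unidirectional o c uniform
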